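{- Let $a$ be an integer with $|a|\ge 6$ and $|a|=p_1^s$ for some prime $p_1$ and some integer $s\ge 1$. Let $b=1$ and let $(u_n)_{n\ge 0}$ be defined by $u_0=0$, $u_1=1$, $u_{n+1}=au_n+bu_{n-1}$ for $n\ge 1$, so that $u_4=a(a^2+2)$ and $u_6=a(a^2+1)(a^2+3)$. Then: (1) if $p_1\neq 3$, then $u_4$ has at least two distinct prime factors $p_2,p_3$, both different from $p_1$; (2) if $|a|=3^s$ with $s\ge 2$, then $u_6$ has at least three distinct prime factors $p_2,p_3,p_4$, all different from $p_1=3$. -}

module Defs where

open import Data.Nat using (ℕ; zero; suc)
open import Data.Integer using (ℤ; _+_; _*_; +_)

u : ℤ → ℤ → ℕ → ℤ
u a b zero = + 0
u a b (suc zero) = + 1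
u a b (suc (suc n)) = a * u a b (suc n) + b * u a b n

-- With x = ∣a∣ = p₁ˢ we have ∣u₄∣ = x(x² + 2) and ∣u₆∣ = x(x² + 1)(x² + 3).
--
-- If p₁ is odd then 3 ∤ x, so 3 ∣ x² + 2, and x² + 2 is not a power of 3: the only solutions
-- of x² + 2 = 3ᵏ have x ≤ 5. Indeed a solution of a² + 2b² = 3ᵏ with 3 ∤ gcd(a, b) gives
-- a + b√-2 = ±(1 ± √-2)ᵏ, by repeatedly dividing by 1 + √-2, an element of norm 3; and the
-- √-2-coordinate of (1 + √-2)ᵏ is never ±1 for k ≥ 4, which a periodicity argument modulo
-- 3⁴·163 verifies. Any other prime divisor of x² + 2 differs from p₁, as it does not divide 2.
-- If p₁ = 2 then x² + 2 = 2(32·4ᵗ + 1), and the odd factor is divisible by 3 but is not a power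
-- of 3, as seen modulo 160.
--
-- If x = 3ˢ with s ≥ 2 then x² + 1 ≡ 2 and (x² + 3)/3 ≡ 4 (mod 8) are ≡ 1 (mod 3) and larger
-- than 4, so each has an odd prime divisor other than 3; these two are distinct because
-- (x² + 3) − (x² + 1) = 2. Together with 2 ∣ x² + 1 this gives three primes.

module Submission where

open import Defs using (u)

module Arithmetic where

  open import Algebra.Properties.CommutativeSemigroup using (interchange)
  open import Data.Empty using (⊥-elim)
  import Data.List as List
  open import Data.List.Membership.Propositional using (find)
  open import Data.List.Relation.Unary.All as All using (All; []; _∷_)
  open import Data.List.Relation.Unary.All.Properties using (¬All⇒Any¬)
  open import Data.Nat
  open import Data.Nat.DivMod
  open import Data.Nat.Divisibility
  open import Data.Nat.ListAction using (product)
  open import Data.Nat.ListAction.Properties using (∈⇒∣product)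
  open import Data.Nat.Primality
  open import Data.Nat.Primality.Factorisation using (factorise)
  open import Data.Nat.Properties
  open import Data.Product using (_×_; _,_; ∃-syntax)
  open import Data.Sum using (_⊎_; inj₁; inj₂)
  open import Function using (_∘_)
  open import Relation.Binary.PropositionalEquality
  open import Relation.Nullary using (¬_; yes; no)
  open import Relation.Nullary.Decidable using (from-yes)

  module _ {A : Set} (f : A → A) (s : ℕ → A) (s-orbit : ∀ n → s (suc n) ≡ f (s n)) where

    orbit-shift : ∀ {p} → s p ≡ s 0 → ∀ n → s (n + p) ≡ s n
    orbit-shift sp≡s0 zero = sp≡s0
    orbit-shift {p} sp≡s0 (suc n) =
      trans (s-orbit (n + p)) (trans (cong f (orbit-shift sp≡s0 n)) (sym (s-orbit n)))

    orbit-periodic : ∀ p .{{_ : NonZero p}} → s p ≡ s 0 → ∀ n → s n ≡ s (n % p)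
    orbit-periodic p sp≡s0 n =
      trans (cong s (m≡m%n+[m/n]*n n p)) (shift-by-multiple (n % p) (n / p))
      where
      shift-by-multiple : ∀ r q → s (r + q * p) ≡ s r
      shift-by-multiple r zero = cong s (+-identityʳ r)
      shift-by-multiple r (suc q) = begin
        s (r + (p + q * p))  ≡⟨ cong (λ k → s (r + k)) (+-comm p (q * p)) ⟩
        s (r + (q * p + p))  ≡⟨ cong s (+-assoc r (q * p) p) ⟨
        s (r + q * p + p)    ≡⟨ orbit-shift sp≡s0 (r + q * p) ⟩
        s (r + q * p)        ≡⟨ shift-by-multiple r q ⟩
        s r                  ∎
        where open ≡-Reasoning

  [m*[n%d]]%d≡[m*n]%d : ∀ m n d .{{_ : NonZero d}} → (m * (n % d)) % d ≡ (m * n) % d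
  [m*[n%d]]%d≡[m*n]%d m n d = begin
    (m * (n % d)) % d              ≡⟨ %-distribˡ-* m (n % d) d ⟩
    ((m % d) * (n % d % d)) % d    ≡⟨ cong (λ v → ((m % d) * v) % d) (m%n%n≡m%n n d) ⟩
    ((m % d) * (n % d)) % d        ≡⟨ %-distribˡ-* m n d ⟨
    (m * n) % d                    ∎
    where open ≡-Reasoning

  [m*[n%d]+k]%d≡[m*n+k]%d : ∀ m n k d .{{_ : NonZero d}} →
                            (m * (n % d) + k) % d ≡ (m * n + k) % d
  [m*[n%d]+k]%d≡[m*n+k]%d m n k d = begin
    (m * (n % d) + k) % d              ≡⟨ %-distribˡ-+ (m * (n % d)) k d ⟩
    ((m * (n % d)) % d + k % d) % d    ≡⟨ cong (λ v → (v + k % d) % d) ([m*[n%d]]%d≡[m*n]%d m n d) ⟩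
    ((m * n) % d + k % d) % d          ≡⟨ %-distribˡ-+ (m * n) k d ⟨
    (m * n + k) % d                    ∎
    where open ≡-Reasoning

  m%d≡1⇒m^k%d≡1 : ∀ m k d .{{_ : NonZero d}} → m % d ≡ 1 → m ^ k % d ≡ 1
  m%d≡1⇒m^k%d≡1 m zero d m%d≡1 = trans (cong (_% d) (sym m%d≡1)) (trans (m%n%n≡m%n m d) m%d≡1)
  m%d≡1⇒m^k%d≡1 m (suc k) d m%d≡1 = begin
    (m * m ^ k) % d                ≡⟨ %-distribˡ-* m (m ^ k) d ⟩
    ((m % d) * (m ^ k % d)) % d    ≡⟨ cong₂ (λ x y → (x * y) % d) m%d≡1 (m%d≡1⇒m^k%d≡1 m k d m%d≡1) ⟩
    1 % d                          ≡⟨ m%d≡1⇒m^k%d≡1 m zero d m%d≡1 ⟩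
    1                              ∎
    where open ≡-Reasoning

  [c*m^k+e]%d≡[c+e]%d : ∀ c m k e d .{{_ : NonZero d}} → m % d ≡ 1 →
                        (c * m ^ k + e) % d ≡ (c + e) % d
  [c*m^k+e]%d≡[c+e]%d c m k e d m%d≡1 = begin
    (c * m ^ k + e) % d          ≡⟨ [m*[n%d]+k]%d≡[m*n+k]%d c (m ^ k) e d ⟨
    (c * (m ^ k % d) + e) % d    ≡⟨ cong (λ v → (c * v + e) % d) (m%d≡1⇒m^k%d≡1 m k d m%d≡1) ⟩
    (c * 1 + e) % d              ≡⟨ cong (λ v → (v + e) % d) (*-identityʳ c) ⟩
    (c + e) % d                  ∎
    where open ≡-Reasoning

  3∤m⇒3∣m*m+2 : ∀ m → ¬ 3 ∣ m → 3 ∣ m * m + 2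
  3∤m⇒3∣m*m+2 m 3∤m = m%n≡0⇒n∣m (m * m + 2) 3 (begin
    (m * m + 2) % 3      ≡⟨ [m*[n%d]+k]%d≡[m*n+k]%d m m 2 3 ⟨
    (m * r + 2) % 3      ≡⟨ cong (λ v → (v + 2) % 3) (*-comm m r) ⟩
    (r * m + 2) % 3      ≡⟨ [m*[n%d]+k]%d≡[m*n+k]%d r m 2 3 ⟨
    (r * r + 2) % 3      ≡⟨ nonzero-residue r (m%n<n m 3) (3∤m ∘ m%n≡0⇒n∣m m 3) ⟩
    0                    ∎)
    where
    open ≡-Reasoning
    r : ℕ
    r = m % 3
    nonzero-residue : ∀ r → r < 3 → r ≢ 0 → (r * r + 2) % 3 ≡ 0
    nonzero-residue 0 _ r≢0 = ⊥-elim (r≢0 refl)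
    nonzero-residue 1 _ _ = refl
    nonzero-residue 2 _ _ = refl
    nonzero-residue (suc (suc (suc _))) (s≤s (s≤s (s≤s ()))) _

  m+[1+n]≢0 : ∀ m {n} → NonZero (m + suc n)
  m+[1+n]≢0 zero = _
  m+[1+n]≢0 (suc m) = _

  m^n*m^n≡[m*m]^n : ∀ m n → m ^ n * m ^ n ≡ (m * m) ^ n
  m^n*m^n≡[m*m]^n m zero = refl
  m^n*m^n≡[m*m]^n m (suc n) =
    trans (interchange *-commutativeSemigroup m (m ^ n) m (m ^ n))
          (cong (m * m *_) (m^n*m^n≡[m*m]^n m n))

  prime[3] : Prime 3
  prime[3] = from-yes (prime? 3)

  prime∤1 : ∀ {q} → Prime q → ¬ q ∣ 1
  prime∤1 q-prime q∣1 = ¬prime[1] (subst Prime (∣1⇒≡1 q∣1) q-prime)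

  prime∣2⇒≡2 : ∀ {q} → Prime q → q ∣ 2 → q ≡ 2
  prime∣2⇒≡2 q-prime q∣2 with prime⇒irreducible prime[2] q∣2
  ... | inj₁ refl = ⊥-elim (¬prime[1] q-prime)
  ... | inj₂ q≡2 = q≡2

  prime∣m^k⇒∣m : ∀ {q} m k → Prime q → q ∣ m ^ k → q ∣ m
  prime∣m^k⇒∣m m zero q-prime q∣1 = ⊥-elim (prime∤1 q-prime q∣1)
  prime∣m^k⇒∣m m (suc k) q-prime q∣m*m^k with euclidsLemma m (m ^ k) q-prime q∣m*m^k
  ... | inj₁ q∣m = q∣m
  ... | inj₂ q∣m^k = prime∣m^k⇒∣m m k q-prime q∣m^k

  prime-power⊎prime-divisor : ∀ p n .{{_ : NonZero n}} →
                              (∃[ k ] n ≡ p ^ k) ⊎ (∃[ q ] Prime q × q ≢ p × q ∣ n)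
  prime-power⊎prime-divisor p n with factorise n
  ... | record { factors = qs ; isFactorisation = n≡∏qs ; factorsPrime = qs-prime }
    with All.all? (_≟ p) qs
  ... | yes all≡p = inj₁ (List.length qs , trans n≡∏qs (product-replicate all≡p))
    where
    product-replicate : ∀ {qs} → All (_≡ p) qs → product qs ≡ p ^ List.length qs
    product-replicate [] = refl
    product-replicate (refl ∷ qs≡p) = cong (p *_) (product-replicate qs≡p)
  ... | no ¬all≡p with find (¬All⇒Any¬ (_≟ p) qs ¬all≡p)
  ... | q , q∈qs , q≢p =
    inj₂ (q , All.lookup qs-prime q∈qs , q≢p , subst (q ∣_) (sym n≡∏qs) (∈⇒∣product q∈qs))

  odd-prime-divisor : ∀ n → 4 < n → ¬ 8 ∣ n → ∃[ q ] Prime q × q ≢ 2 × q ∣ n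
  odd-prime-divisor n 4<n 8∤n with prime-power⊎prime-divisor 2 n {{>-nonZero (<-trans z<s 4<n)}}
  ... | inj₂ odd-q = odd-q
  ... | inj₁ (i , refl) = ⊥-elim (8∤n (4<2^i⇒8∣2^i i 4<n))
    where
    4<2^i⇒8∣2^i : ∀ i → 4 < 2 ^ i → 8 ∣ 2 ^ i
    4<2^i⇒8∣2^i 0 (s≤s ())
    4<2^i⇒8∣2^i 1 (s≤s (s≤s ()))
    4<2^i⇒8∣2^i 2 (s≤s (s≤s (s≤s (s≤s ()))))
    4<2^i⇒8∣2^i (suc (suc (suc i))) _ =
      divides (2 ^ i) (trans (^-distribˡ-+-* 2 3 i) (*-comm 8 (2 ^ i)))

module SquarePlusTwiceSquare where

  open import Data.Empty using (⊥-elim)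
  open import Data.Integer using (ℤ; +_; -[1+_]; -_; _+_; _-_; _*_; ∣_∣; _%ℕ_; _/ℕ_)
  open import Data.Integer.DivMod using (a≡a%ℕn+[a/ℕn]*n)
  open import Data.Integer.Divisibility.Signed
    using (_∣_; _∣?_; divides; ∣-refl; ∣ᵤ⇒∣; ∣⇒∣ᵤ; ∣m∣n⇒∣m+n; ∣m∣n⇒∣m-n; ∣m⇒∣-m; ∣n⇒∣m*n; ∣m+n∣n⇒∣m)
  open import Data.Integer.Properties
    using (pos-+; pos-*; abs-*; neg-involutive; *-comm; *-cancelˡ-≡; +-injective; ∣i∣≡0⇒i≡0)
  open import Data.Integer.Tactic.RingSolver using (solve-∀)
  open import Data.Nat as ℕ using (ℕ; zero; suc; _^_)
  open import Data.Nat.DivMod using (m%n<n)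
  import Data.Nat.Divisibility as ℕ
  open import Data.Nat.Primality using (Prime; euclidsLemma)
  import Data.Nat.Properties as ℕ
  open import Data.Product using (_×_; _,_; proj₁; proj₂)
  open import Data.Sum as Sum using (_⊎_; inj₁; inj₂)
  open import Relation.Binary.PropositionalEquality
  open import Relation.Nullary using (¬_; Dec; yes; no)
  open import Relation.Nullary.Decidable using (from-yes; from-no; ¬?; _×-dec_)
  open Arithmetic using (orbit-periodic; prime[3]; prime∤1)

  prime∣i*j⇒∣i⊎∣j : ∀ {p} → Prime p → ∀ i j → + p ∣ i * j → (+ p ∣ i) ⊎ (+ p ∣ j)
  prime∣i*j⇒∣i⊎∣j {p} p-prime i j p∣ij = Sum.map ∣ᵤ⇒∣ ∣ᵤ⇒∣
    (euclidsLemma ∣ i ∣ ∣ j ∣ p-prime (subst (ℕ._∣_ p) (abs-* i j) (∣⇒∣ᵤ p∣ij)))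

  i*i≡+∣i∣*∣i∣ : ∀ i → i * i ≡ + (∣ i ∣ ℕ.* ∣ i ∣)
  i*i≡+∣i∣*∣i∣ (+ n) = sym (pos-* n n)
  i*i≡+∣i∣*∣i∣ -[1+ n ] = refl

  -- A n + B n √-2 = (1 + √-2)ⁿ
  A B : ℕ → ℤ
  A zero = + 1
  A (suc n) = A n - + 2 * B n
  B zero = + 0
  B (suc n) = A n + B n

  Primitive : ℤ → ℤ → Set
  Primitive a b = ¬ ((+ 3 ∣ a) × (+ 3 ∣ b))

  -- a + b √-2 is one of ±(1 + √-2)ⁿ and ±(1 - √-2)ⁿ
  ±Power : ℕ → ℤ → ℤ → Set
  ±Power n a b = (a ≡ A n ⊎ a ≡ - A n) × (b ≡ B n ⊎ b ≡ - B n)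

  [a-2b]²+2[a+b]²≡3[a²+2b²] : ∀ a b →
    (a - + 2 * b) * (a - + 2 * b) + + 2 * ((a + b) * (a + b)) ≡ + 3 * (a * a + + 2 * (b * b))
  [a-2b]²+2[a+b]²≡3[a²+2b²] = solve-∀

  3∣a²+2b²⇒3∣a-b⊎3∣a+b : ∀ a b → + 3 ∣ a * a + + 2 * (b * b) → (+ 3 ∣ a - b) ⊎ (+ 3 ∣ a + b)
  3∣a²+2b²⇒3∣a-b⊎3∣a+b a b 3∣a²+2b² = prime∣i*j⇒∣i⊎∣j prime[3] (a - b) (a + b)
    (∣m+n∣n⇒∣m (subst (+ 3 ∣_) (a²+2b²≡ a b) 3∣a²+2b²) (∣n⇒∣m*n (b * b) ∣-refl))
    where
    a²+2b²≡ : ∀ a b → a * a + + 2 * (b * b) ≡ (a - b) * (a + b) + b * b * + 3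
    a²+2b²≡ = solve-∀

  -- (1 - √-2)ⁿ⁺¹ (1 + √-2) is divisible by 3 = (1 - √-2)(1 + √-2).
  3∣mixed-signs : ∀ n → (+ 3 ∣ A (suc n) - + 2 * - B (suc n)) × (+ 3 ∣ A (suc n) - B (suc n))
  3∣mixed-signs n = subst (+ 3 ∣_) (a-b+3b≡a-2[-b] (A (suc n)) (B (suc n))) 3∣A-B+3B , 3∣A-B
    where
    a-2b-[a+b]≡-b*3 : ∀ a b → (a - + 2 * b) - (a + b) ≡ - b * + 3
    a-2b-[a+b]≡-b*3 = solve-∀
    a-b+3b≡a-2[-b] : ∀ a b → a - b + b * + 3 ≡ a - + 2 * - b
    a-b+3b≡a-2[-b] = solve-∀
    3∣A-B : + 3 ∣ A (suc n) - B (suc n)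
    3∣A-B = divides (- B n) (a-2b-[a+b]≡-b*3 (A n) (B n))
    3∣A-B+3B : + 3 ∣ A (suc n) - B (suc n) + B (suc n) * + 3
    3∣A-B+3B = ∣m∣n⇒∣m+n 3∣A-B (∣n⇒∣m*n (B (suc n)) ∣-refl)

  ±Power-negʳ : ∀ n {a b} → ±Power n a (- b) → ±Power n a b
  ±Power-negʳ n {b = b} (a≡±A , inj₁ -b≡B) =
    a≡±A , inj₂ (trans (sym (neg-involutive b)) (cong -_ -b≡B))
  ±Power-negʳ n {b = b} (a≡±A , inj₂ -b≡-B) =
    a≡±A , inj₁ (trans (sym (neg-involutive b)) (trans (cong -_ -b≡-B) (neg-involutive (B n))))

  ±Power-suc : ∀ n {a b} → ±Power n a b → Primitive (a - + 2 * b) (a + b) →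
               ±Power (suc n) (a - + 2 * b) (a + b)
  ±Power-suc n (inj₁ refl , inj₁ refl) _ = inj₁ refl , inj₁ refl
  ±Power-suc n (inj₂ refl , inj₂ refl) _ = inj₂ (-a-2[-b]≡ (A n) (B n)) , inj₂ (-a-b≡ (A n) (B n))
    where
    -a-2[-b]≡ : ∀ a b → - a - + 2 * - b ≡ - (a - + 2 * b)
    -a-2[-b]≡ = solve-∀
    -a-b≡ : ∀ a b → - a + - b ≡ - (a + b)
    -a-b≡ = solve-∀
  -- B 0 = + 0, so at n = 0 the mixed sign choices coincide with the unmixed ones.
  ±Power-suc zero (inj₁ refl , inj₂ refl) _ = inj₁ refl , inj₁ refl
  ±Power-suc zero (inj₂ refl , inj₁ refl) _ = inj₂ refl , inj₂ refl
  ±Power-suc (suc n) (inj₁ refl , inj₂ refl) prim = ⊥-elim (prim (3∣mixed-signs n))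
  ±Power-suc (suc n) (inj₂ refl , inj₁ refl) prim = ⊥-elim (prim
    ( subst (+ 3 ∣_) (-[a-2[-b]]≡ (A (suc n)) (B (suc n))) (∣m⇒∣-m (proj₁ (3∣mixed-signs n)))
    , subst (+ 3 ∣_) (-[a-b]≡ (A (suc n)) (B (suc n))) (∣m⇒∣-m (proj₂ (3∣mixed-signs n)))))
    where
    -[a-2[-b]]≡ : ∀ a b → - (a - + 2 * - b) ≡ - a - + 2 * b
    -[a-2[-b]]≡ = solve-∀
    -[a-b]≡ : ∀ a b → - (a + - b) ≡ - a + b
    -[a-b]≡ = solve-∀

  a²+2b²≡1⇒±Power₀ : ∀ a b → a * a + + 2 * (b * b) ≡ + 1 → ±Power 0 a b
  a²+2b²≡1⇒±Power₀ a b a²+2b²≡1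
    with m²+2k²≡1 ∣ a ∣ ∣ b ∣ (+-injective (trans ∣a∣²+2∣b∣²≡ a²+2b²≡1))
    where
    m²+2k²≡1 : ∀ m k → m ℕ.* m ℕ.+ 2 ℕ.* (k ℕ.* k) ≡ 1 → m ≡ 1 × k ≡ 0
    m²+2k²≡1 1 0 _ = refl , refl
    m²+2k²≡1 0 (suc k) eq = ⊥-elim (ℕ.m+1+n≢0 _ (ℕ.suc-injective eq))
    m²+2k²≡1 1 (suc k) ()
    m²+2k²≡1 (suc (suc m)) k ()
    ∣a∣²+2∣b∣²≡ : + (∣ a ∣ ℕ.* ∣ a ∣ ℕ.+ 2 ℕ.* (∣ b ∣ ℕ.* ∣ b ∣)) ≡ a * a + + 2 * (b * b)
    ∣a∣²+2∣b∣²≡ = trans (pos-+ (∣ a ∣ ℕ.* ∣ a ∣) _)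
      (cong₂ _+_ (sym (i*i≡+∣i∣*∣i∣ a))
                 (trans (pos-* 2 (∣ b ∣ ℕ.* ∣ b ∣)) (cong (+ 2 *_) (sym (i*i≡+∣i∣*∣i∣ b)))))
  ... | ∣a∣≡1 , ∣b∣≡0 = ∣i∣≡1⇒i≡±1 a ∣a∣≡1 , inj₁ (∣i∣≡0⇒i≡0 ∣b∣≡0)
    where
    ∣i∣≡1⇒i≡±1 : ∀ i → ∣ i ∣ ≡ 1 → i ≡ + 1 ⊎ i ≡ - + 1
    ∣i∣≡1⇒i≡±1 (+ .1) refl = inj₁ refl
    ∣i∣≡1⇒i≡±1 -[1+ .0 ] refl = inj₂ refl

  -- a′ + b′ √-2 is the quotient of a + b √-2 by 1 + √-2.
  divide-by-1+√-2 : ∀ n →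
    (∀ a b → a * a + + 2 * (b * b) ≡ + (3 ^ n) → Primitive a b → ±Power n a b) →
    ∀ {a b} → + 3 ∣ a - b → a * a + + 2 * (b * b) ≡ + (3 ^ suc n) → Primitive a b →
    ±Power (suc n) a b
  divide-by-1+√-2 n ±Power-n {a} {b} (divides t a-b≡t*3) a²+2b²≡3^[1+n] prim =
    subst₂ (±Power (suc n)) a′-2b′≡a a′+b′≡b
      (±Power-suc n (±Power-n a′ b′ a′²+2b′²≡3^n prim′)
                    (subst₂ Primitive (sym a′-2b′≡a) (sym a′+b′≡b) prim))
    where
    open ≡-Reasoning
    a′ b′ : ℤ
    a′ = b + t
    b′ = - t
    a′-2b′≡a : a′ - + 2 * b′ ≡ a
    a′-2b′≡a = begin
      (b + t) - + 2 * - t  ≡⟨ b+t-2[-t]≡ b t ⟩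
      t * + 3 + b          ≡⟨ cong (_+ b) a-b≡t*3 ⟨
      a - b + b            ≡⟨ a-b+b≡a a b ⟩
      a                    ∎
      where
      b+t-2[-t]≡ : ∀ b t → (b + t) - + 2 * - t ≡ t * + 3 + b
      b+t-2[-t]≡ = solve-∀
      a-b+b≡a : ∀ a b → a - b + b ≡ a
      a-b+b≡a = solve-∀
    a′+b′≡b : a′ + b′ ≡ b
    a′+b′≡b = b+t-t≡b b t
      where
      b+t-t≡b : ∀ b t → b + t + - t ≡ b
      b+t-t≡b = solve-∀
    a′²+2b′²≡3^n : a′ * a′ + + 2 * (b′ * b′) ≡ + (3 ^ n)
    a′²+2b′²≡3^n = *-cancelˡ-≡ (+ 3) _ _ (begin
      + 3 * (a′ * a′ + + 2 * (b′ * b′))  ≡⟨ [a-2b]²+2[a+b]²≡3[a²+2b²] a′ b′ ⟨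
      _                                   ≡⟨ cong₂ (λ x y → x * x + + 2 * (y * y)) a′-2b′≡a a′+b′≡b ⟩
      a * a + + 2 * (b * b)              ≡⟨ a²+2b²≡3^[1+n] ⟩
      + (3 ^ suc n)                       ≡⟨ pos-* 3 (3 ^ n) ⟩
      + 3 * + (3 ^ n)                     ∎)
    prim′ : Primitive a′ b′
    prim′ (3∣a′ , 3∣b′) = prim
      ( subst (+ 3 ∣_) a′-2b′≡a (∣m∣n⇒∣m-n 3∣a′ (∣n⇒∣m*n (+ 2) 3∣b′))
      , subst (+ 3 ∣_) a′+b′≡b (∣m∣n⇒∣m+n 3∣a′ 3∣b′))

  primitive-a²+2b²≡3^n⇒±Power : ∀ n a b → a * a + + 2 * (b * b) ≡ + (3 ^ n) → Primitive a b →
                                ±Power n a b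
  primitive-a²+2b²≡3^n⇒±Power zero a b a²+2b²≡1 _ = a²+2b²≡1⇒±Power₀ a b a²+2b²≡1
  primitive-a²+2b²≡3^n⇒±Power (suc n) a b a²+2b²≡3^[1+n] prim
    with 3∣a²+2b²⇒3∣a-b⊎3∣a+b a b 3∣a²+2b²
    where
    3∣a²+2b² : + 3 ∣ a * a + + 2 * (b * b)
    3∣a²+2b² = divides (+ (3 ^ n))
      (trans a²+2b²≡3^[1+n] (trans (pos-* 3 (3 ^ n)) (*-comm (+ 3) (+ (3 ^ n)))))
  ... | inj₁ 3∣a-b = divide-by-1+√-2 n (primitive-a²+2b²≡3^n⇒±Power n) 3∣a-b a²+2b²≡3^[1+n] prim
  ... | inj₂ 3∣a+b = ±Power-negʳ (suc n) (divide-by-1+√-2 n (primitive-a²+2b²≡3^n⇒±Power n)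
          3∣a-[-b] (trans (a²+2[-b]²≡a²+2b² a b) a²+2b²≡3^[1+n]) prim-negʳ)
    where
    a²+2[-b]²≡a²+2b² : ∀ a b → a * a + + 2 * (- b * - b) ≡ a * a + + 2 * (b * b)
    a²+2[-b]²≡a²+2b² = solve-∀
    3∣a-[-b] : + 3 ∣ a - - b
    3∣a-[-b] = subst (λ c → + 3 ∣ a + c) (sym (neg-involutive b)) 3∣a+b
    prim-negʳ : Primitive a (- b)
    prim-negʳ (3∣a , 3∣-b) = prim (3∣a , subst (+ 3 ∣_) (neg-involutive b) (∣m⇒∣-m 3∣-b))

  B-rec : ∀ n → B (suc (suc n)) ≡ + 2 * B (suc n) - + 3 * B n
  B-rec n = a-2b+[a+b]≡ (A n) (B n)
    where
    a-2b+[a+b]≡ : ∀ a b → (a - + 2 * b) + (a + b) ≡ + 2 * (a + b) - + 3 * b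
    a-2b+[a+b]≡ = solve-∀

  -- M = 3⁴·163: the residues of (B k , B (k + 1)) modulo M are periodic with period 162 from
  -- k = 4 on, and on that cycle B k is never ≡ ±1.
  M : ℕ
  M = 13203

  next-residues : ℕ × ℕ → ℕ × ℕ
  next-residues (x , y) = y , (+ 2 * + y - + 3 * + x) %ℕ M

  residues : ℕ → ℕ × ℕ
  residues zero = 0 , 1
  residues (suc k) = next-residues (residues k)

  M∣i-i%M : ∀ i → + M ∣ i - + (i %ℕ M)
  M∣i-i%M i = divides (i /ℕ M) (begin
    i - + r                    ≡⟨ cong (_- + r) (a≡a%ℕn+[a/ℕn]*n i M) ⟩
    + r + i /ℕ M * + M - + r   ≡⟨ r+x-r≡x (+ r) (i /ℕ M * + M) ⟩
    i /ℕ M * + M               ∎)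
    where
    open ≡-Reasoning
    r : ℕ
    r = i %ℕ M
    r+x-r≡x : ∀ r x → r + x - r ≡ x
    r+x-r≡x = solve-∀

  B≡residues : ∀ k → (+ M ∣ B k - + proj₁ (residues k)) × (+ M ∣ B (suc k) - + proj₂ (residues k))
  B≡residues zero = divides (+ 0) refl , divides (+ 0) refl
  B≡residues (suc k) with residues k | B≡residues k
  ... | x , y | M∣B[k]-x , M∣B[1+k]-y = M∣B[1+k]-y , subst (+ M ∣_) (sym B[2+k]-r≡)
    (∣m∣n⇒∣m+n (∣m∣n⇒∣m-n (∣n⇒∣m*n (+ 2) M∣B[1+k]-y) (∣n⇒∣m*n (+ 3) M∣B[k]-x)) (M∣i-i%M e))
    where
    e : ℤ
    e = + 2 * + y - + 3 * + x
    regroup : ∀ Y X x y r → (+ 2 * Y - + 3 * X) - r ≡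
                           (+ 2 * (Y - y) - + 3 * (X - x)) + ((+ 2 * y - + 3 * x) - r)
    regroup = solve-∀
    B[2+k]-r≡ : B (suc (suc k)) - + (e %ℕ M) ≡
                (+ 2 * (B (suc k) - + y) - + 3 * (B k - + x)) + (e - + (e %ℕ M))
    B[2+k]-r≡ = trans (cong (_- + (e %ℕ M)) (B-rec k)) (regroup (B (suc k)) (B k) (+ x) (+ y) (+ (e %ℕ M)))

  ≢±1[mod-M] : ℕ → Set
  ≢±1[mod-M] x = ¬ (+ M ∣ + 1 - + x) × ¬ (+ M ∣ - + 1 - + x)

  residues≢±1 : ∀ n → ≢±1[mod-M] (proj₁ (residues (4 ℕ.+ n)))
  residues≢±1 n = subst (λ s → ≢±1[mod-M] (proj₁ s))
    (sym (orbit-periodic next-residues (λ k → residues (4 ℕ.+ k)) (λ _ → refl) 162 refl n))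
    (on-cycle (m%n<n n 162))
    where
    ≢±1[mod-M]? : ∀ x → Dec (≢±1[mod-M] x)
    ≢±1[mod-M]? x = ¬? (+ M ∣? + 1 - + x) ×-dec ¬? (+ M ∣? - + 1 - + x)
    on-cycle : ∀ {r} → r ℕ.< 162 → ≢±1[mod-M] (proj₁ (residues (4 ℕ.+ r)))
    on-cycle = from-yes (ℕ.allUpTo? (λ r → ≢±1[mod-M]? (proj₁ (residues (4 ℕ.+ r)))) 162)

  B≡c⇒M∣c-residue : ∀ k {c} → B k ≡ c → + M ∣ c - + proj₁ (residues k)
  B≡c⇒M∣c-residue k refl = proj₁ (B≡residues k)

  B[4+n]≢±1 : ∀ n → ¬ (B (4 ℕ.+ n) ≡ + 1 ⊎ B (4 ℕ.+ n) ≡ - + 1)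
  B[4+n]≢±1 n (inj₁ B≡1) = proj₁ (residues≢±1 n) (B≡c⇒M∣c-residue (4 ℕ.+ n) B≡1)
  B[4+n]≢±1 n (inj₂ B≡-1) = proj₂ (residues≢±1 n) (B≡c⇒M∣c-residue (4 ℕ.+ n) B≡-1)

  x²+2≢3^[4+n] : ∀ x n → x ℕ.* x ℕ.+ 2 ≢ 3 ^ (4 ℕ.+ n)
  x²+2≢3^[4+n] x n x²+2≡3^[4+n] = B[4+n]≢±1 n (±1≡B⇒B≡±1 (proj₂ ±Power[x,1]))
    where
    ±Power[x,1] : ±Power (4 ℕ.+ n) (+ x) (+ 1)
    ±Power[x,1] = primitive-a²+2b²≡3^n⇒±Power (4 ℕ.+ n) (+ x) (+ 1)
      (trans (cong (_+ + 2) (sym (pos-* x x))) (trans (sym (pos-+ (x ℕ.* x) 2)) (cong +_ x²+2≡3^[4+n])))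
      (λ (_ , 3∣1) → prime∤1 prime[3] (∣⇒∣ᵤ 3∣1))
    ±1≡B⇒B≡±1 : + 1 ≡ B (4 ℕ.+ n) ⊎ + 1 ≡ - B (4 ℕ.+ n) → B (4 ℕ.+ n) ≡ + 1 ⊎ B (4 ℕ.+ n) ≡ - + 1
    ±1≡B⇒B≡±1 (inj₁ 1≡B) = inj₁ (sym 1≡B)
    ±1≡B⇒B≡±1 (inj₂ 1≡-B) = inj₂ (trans (sym (neg-involutive _)) (cong -_ (sym 1≡-B)))

  x²+2≡3^k⇒x≤5 : ∀ x k → x ℕ.* x ℕ.+ 2 ≡ 3 ^ k → x ℕ.≤ 5
  x²+2≡3^k⇒x≤5 x k x²+2≡3^k with 4 ℕ.≤? k
  ... | yes 4≤k = ⊥-elim (x²+2≢3^[4+n] x (k ℕ.∸ 4)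
                    (trans x²+2≡3^k (cong (3 ^_) (sym (ℕ.m+[n∸m]≡n 4≤k)))))
  ... | no 4≰k = ℕ.≮⇒≥ (λ 5<x → from-no (36 ℕ.≤? 27) (begin
    36                ≤⟨ ℕ.*-mono-≤ 5<x 5<x ⟩
    x ℕ.* x           ≤⟨ ℕ.m≤m+n (x ℕ.* x) 2 ⟩
    x ℕ.* x ℕ.+ 2     ≡⟨ x²+2≡3^k ⟩
    3 ^ k             ≤⟨ ℕ.^-monoʳ-≤ 3 (ℕ.≤-pred (ℕ.≰⇒> 4≰k)) ⟩
    27                ∎))
    where open ℕ.≤-Reasoning

module LucasTerms where

  open import Data.Integer using (ℤ; +_; _+_; _*_; ∣_∣)
  open import Data.Integer.Properties using (pos-+; abs-*; *-identityˡ)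
  open import Data.Integer.Tactic.RingSolver using (solve)
  open import Data.List using ([]; _∷_)
  open import Data.Nat as ℕ using (ℕ; suc)
  open import Relation.Binary.PropositionalEquality
  open SquarePlusTwiceSquare using (i*i≡+∣i∣*∣i∣)

  ∣i*i+n∣≡∣i∣*∣i∣+n : ∀ i n → ∣ i * i + + n ∣ ≡ ∣ i ∣ ℕ.* ∣ i ∣ ℕ.+ n
  ∣i*i+n∣≡∣i∣*∣i∣+n i n = cong ∣_∣ (trans (cong (_+ + n) (i*i≡+∣i∣*∣i∣ i)) (sym (pos-+ _ n)))

  module _ (a : ℤ) where

    private
      v : ℕ → ℤ
      v = u a (+ 1)

      v-rec : ∀ n {x y z} → v (suc n) ≡ x → v n ≡ y → a * x + y ≡ z → v (suc (suc n)) ≡ z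
      v-rec n v[1+n]≡x v[n]≡y ax+y≡z = trans (cong (λ w → a * v (suc n) + w) (*-identityˡ (v n)))
        (trans (cong₂ (λ x y → a * x + y) v[1+n]≡x v[n]≡y) ax+y≡z)

      u₂≡ : v 2 ≡ a
      u₂≡ = v-rec 0 refl refl (solve (a ∷ []))

      u₃≡ : v 3 ≡ a * a + + 1
      u₃≡ = v-rec 1 u₂≡ refl (solve (a ∷ []))

    u₄≡ : u a (+ 1) 4 ≡ a * (a * a + + 2)
    u₄≡ = v-rec 2 u₃≡ u₂≡ (solve (a ∷ []))

    private
      u₅≡ : v 5 ≡ a * a * (a * a + + 3) + + 1
      u₅≡ = v-rec 3 u₄≡ u₃≡ (solve (a ∷ []))

    u₆≡ : u a (+ 1) 6 ≡ a * ((a * a + + 1) * (a * a + + 3))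
    u₆≡ = v-rec 4 u₅≡ u₄≡ (solve (a ∷ []))

    ∣u₄∣≡ : ∣ u a (+ 1) 4 ∣ ≡ ∣ a ∣ ℕ.* (∣ a ∣ ℕ.* ∣ a ∣ ℕ.+ 2)
    ∣u₄∣≡ = trans (cong ∣_∣ u₄≡) (trans (abs-* a _) (cong (∣ a ∣ ℕ.*_) (∣i*i+n∣≡∣i∣*∣i∣+n a 2)))

    ∣u₆∣≡ : ∣ u a (+ 1) 6 ∣ ≡ ∣ a ∣ ℕ.* ((∣ a ∣ ℕ.* ∣ a ∣ ℕ.+ 1) ℕ.* (∣ a ∣ ℕ.* ∣ a ∣ ℕ.+ 3))
    ∣u₆∣≡ = trans (cong ∣_∣ u₆≡) (trans (abs-* a _) (cong (∣ a ∣ ℕ.*_)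
      (trans (abs-* (a * a + + 1) _) (cong₂ ℕ._*_ (∣i*i+n∣≡∣i∣*∣i∣+n a 1) (∣i*i+n∣≡∣i∣*∣i∣+n a 3)))))

module PrimeDivisors where

  open import Data.Empty using (⊥-elim)
  open import Data.Nat
  open import Data.Nat.DivMod
  open import Data.Nat.Divisibility
  open import Data.Nat.Primality
  open import Data.Nat.Properties
  open import Data.Nat.Tactic.RingSolver using (solve-∀)
  open import Data.Product using (_×_; _,_; ∃-syntax)
  open import Data.Sum using (inj₁; inj₂)
  open import Function using (_∘_)
  open import Relation.Binary.PropositionalEquality
  open import Relation.Nullary using (¬_; yes; no)
  open import Relation.Nullary.Decidable using (from-yes; ¬?)
  open Arithmetic
  open SquarePlusTwiceSquare using (x²+2≡3^k⇒x≤5)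

  TwoPrimeDivisorsOtherThan : ℕ → ℕ → Set
  TwoPrimeDivisorsOtherThan p n =
    ∃[ p₂ ] ∃[ p₃ ] (Prime p₂ × Prime p₃ × p₂ ≢ p₃ × p₂ ≢ p × p₃ ≢ p × p₂ ∣ n × p₃ ∣ n)

  ThreePrimeDivisorsOtherThan : ℕ → ℕ → Set
  ThreePrimeDivisorsOtherThan p n = ∃[ p₂ ] ∃[ p₃ ] ∃[ p₄ ] (Prime p₂ × Prime p₃ × Prime p₄
    × p₂ ≢ p₃ × p₂ ≢ p₄ × p₃ ≢ p₄ × p₂ ≢ p × p₃ ≢ p × p₄ ≢ p × p₂ ∣ n × p₃ ∣ n × p₄ ∣ n)

  twoPrimeDivisors-∣ : ∀ {p m n} → TwoPrimeDivisorsOtherThan p m → m ∣ n →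
                       TwoPrimeDivisorsOtherThan p n
  twoPrimeDivisors-∣ (p₂ , p₃ , p₂-prime , p₃-prime , p₂≢p₃ , p₂≢p , p₃≢p , p₂∣m , p₃∣m) m∣n =
    p₂ , p₃ , p₂-prime , p₃-prime , p₂≢p₃ , p₂≢p , p₃≢p , ∣-trans p₂∣m m∣n , ∣-trans p₃∣m m∣n

  twoPrimeDivisors-x²+2 : ∀ p x → Prime p → p ≢ 2 → p ∣ x → ¬ 3 ∣ x → 6 ≤ x →
                          TwoPrimeDivisorsOtherThan p (x * x + 2)
  twoPrimeDivisors-x²+2 p x p-prime p≢2 p∣x 3∤x 6≤x
    with prime-power⊎prime-divisor 3 (x * x + 2) {{m+[1+n]≢0 (x * x)}}
  ... | inj₁ (k , x²+2≡3^k) = ⊥-elim (<⇒≱ (s≤s (x²+2≡3^k⇒x≤5 x k x²+2≡3^k)) 6≤x)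
  ... | inj₂ (q , q-prime , q≢3 , q∣x²+2) =
    3 , q , prime[3] , q-prime , q≢3 ∘ sym , 3≢p , q≢p , 3∤m⇒3∣m*m+2 x 3∤x , q∣x²+2
    where
    3≢p : 3 ≢ p
    3≢p refl = 3∤x p∣x
    q≢p : q ≢ p
    q≢p refl = p≢2 (prime∣2⇒≡2 p-prime (∣m+n∣m⇒∣n q∣x²+2 (∣-trans p∣x (m∣m*n x))))

  -- 160 = 2⁵·5: 3ʲ ≡ 1 (mod 32) forces 8 ∣ j, hence 3ʲ ≡ 1 (mod 5), while 32·4ᵗ + 1 ≡ 3 or 4 (mod 5).
  3^j≢32*4^t+1 : ∀ j t → 3 ^ j ≢ 32 * 4 ^ t + 1
  3^j≢32*4^t+1 j t 3^j≡32*4^t+1 = residues-differ (m%n<n j 8) (m%n<n t 2) (begin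
    s₁ (j % 8)  ≡⟨ orbit-periodic (λ v → (3 * v) % 160) s₁ s₁-orbit 8 refl j ⟨
    s₁ j        ≡⟨ cong (_% 160) 3^j≡32*4^t+1 ⟩
    s₂ t        ≡⟨ orbit-periodic (λ v → (4 * v + 157) % 160) s₂ s₂-orbit 2 refl t ⟩
    s₂ (t % 2)  ∎)
    where
    open ≡-Reasoning
    s₁ s₂ : ℕ → ℕ
    s₁ j = 3 ^ j % 160
    s₂ t = (32 * 4 ^ t + 1) % 160
    s₁-orbit : ∀ j → s₁ (suc j) ≡ (3 * s₁ j) % 160
    s₁-orbit j = sym ([m*[n%d]]%d≡[m*n]%d 3 (3 ^ j) 160)
    s₂-orbit : ∀ t → s₂ (suc t) ≡ (4 * s₂ t + 157) % 160
    s₂-orbit t = begin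
      (32 * 4 ^ suc t + 1) % 160              ≡⟨ [m+n]%n≡m%n (32 * 4 ^ suc t + 1) 160 ⟨
      (32 * 4 ^ suc t + 1 + 160) % 160        ≡⟨ cong (_% 160) (32[4y]+1+160≡4[32y+1]+157 (4 ^ t)) ⟩
      (4 * (32 * 4 ^ t + 1) + 157) % 160      ≡⟨ [m*[n%d]+k]%d≡[m*n+k]%d 4 (32 * 4 ^ t + 1) 157 160 ⟨
      (4 * s₂ t + 157) % 160                  ∎
      where
      32[4y]+1+160≡4[32y+1]+157 : ∀ y → 32 * (4 * y) + 1 + 160 ≡ 4 * (32 * y + 1) + 157
      32[4y]+1+160≡4[32y+1]+157 = solve-∀
    residues-differ : ∀ {r r′} → r < 8 → r′ < 2 → s₁ r ≢ s₂ r′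
    residues-differ r<8 =
      from-yes (allUpTo? (λ r → allUpTo? (λ r′ → ¬? (s₁ r ≟ s₂ r′)) 2) 8) r<8

  twoPrimeDivisors-x[x²+2]-2^[3+t] : ∀ t → let x = 2 ^ (3 + t) in
                                     TwoPrimeDivisorsOtherThan 2 (x * (x * x + 2))
  twoPrimeDivisors-x[x²+2]-2^[3+t] t
    with prime-power⊎prime-divisor 3 (32 * 4 ^ t + 1) {{m+[1+n]≢0 (32 * 4 ^ t)}}
  ... | inj₁ (j , T≡3^j) = ⊥-elim (3^j≢32*4^t+1 j t (sym T≡3^j))
  ... | inj₂ (q , q-prime , q≢3 , q∣T) =
    twoPrimeDivisors-∣ (3 , q , prime[3] , q-prime , q≢3 ∘ sym , (λ ()) , q≢2 , 3∣T , q∣T) T∣x[x²+2]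
    where
    x T : ℕ
    x = 2 ^ (3 + t)
    T = 32 * 4 ^ t + 1
    3∣T : 3 ∣ T
    3∣T = m%n≡0⇒n∣m T 3 ([c*m^k+e]%d≡[c+e]%d 32 4 t 1 3 refl)
    q≢2 : q ≢ 2
    q≢2 refl = prime∤1 q-prime (∣m+n∣m⇒∣n q∣T (∣m⇒∣m*n (4 ^ t) (divides 16 refl)))
    x²+2≡2T : x * x + 2 ≡ 2 * T
    x²+2≡2T = trans (cong (_+ 2) (m^n*m^n≡[m*m]^n 2 (3 + t))) (64y+2≡2[32y+1] (4 ^ t))
      where
      64y+2≡2[32y+1] : ∀ y → 4 * (4 * (4 * y)) + 2 ≡ 2 * (32 * y + 1)
      64y+2≡2[32y+1] = solve-∀
    T∣x[x²+2] : T ∣ x * (x * x + 2)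
    T∣x[x²+2] = ∣-trans (n∣m*n 2) (subst (λ n → 2 * T ∣ x * n) (sym x²+2≡2T) (n∣m*n x))

  twoPrimeDivisors-x[x²+2] : ∀ p s x → Prime p → p ≢ 3 → 1 ≤ s → x ≡ p ^ s → 6 ≤ x →
                             TwoPrimeDivisorsOtherThan p (x * (x * x + 2))
  twoPrimeDivisors-x[x²+2] p s x p-prime p≢3 1≤s x≡p^s 6≤x with p ≟ 2
  twoPrimeDivisors-x[x²+2] _ 0 _ _ _ () _ _ | _
  twoPrimeDivisors-x[x²+2] _ 1 _ _ _ _ refl (s≤s (s≤s ())) | yes refl
  twoPrimeDivisors-x[x²+2] _ 2 _ _ _ _ refl (s≤s (s≤s (s≤s (s≤s ())))) | yes refl
  twoPrimeDivisors-x[x²+2] _ (suc (suc (suc t))) _ _ _ _ refl _ | yes refl =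
    twoPrimeDivisors-x[x²+2]-2^[3+t] t
  twoPrimeDivisors-x[x²+2] p (suc s) _ p-prime p≢3 _ refl 6≤x | no p≢2 =
    twoPrimeDivisors-∣ (twoPrimeDivisors-x²+2 p x p-prime p≢2 (m∣m*n (p ^ s)) 3∤x 6≤x) (n∣m*n x)
    where
    x : ℕ
    x = p ^ suc s
    3∤x : ¬ 3 ∣ x
    3∤x 3∣x with prime⇒irreducible p-prime (prime∣m^k⇒∣m p (suc s) prime[3] 3∣x)
    ... | inj₂ 3≡p = p≢3 (sym 3≡p)

  odd-prime-divisor≢3 : ∀ c t .{{_ : NonZero c}} → 3 ∣ c → (c + 1) % 8 ≢ 0 →
                        ∃[ q ] Prime q × q ≢ 2 × q ≢ 3 × q ∣ c * 9 ^ (1 + t) + 1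
  odd-prime-divisor≢3 c t 3∣c [c+1]%8≢0 with odd-prime-divisor (c * y + 1) 4<cy+1 8∤cy+1
    where
    y : ℕ
    y = 9 ^ (1 + t)
    4<cy+1 : 4 < c * y + 1
    4<cy+1 = begin-strict
      4          <⟨ s≤s (s≤s (s≤s (s≤s (s≤s z≤n)))) ⟩
      9 * 1      ≤⟨ *-monoʳ-≤ 9 (m^n>0 9 t) ⟩
      y          ≤⟨ m≤n*m y c ⟩
      c * y      ≤⟨ m≤m+n (c * y) 1 ⟩
      c * y + 1  ∎
      where open ≤-Reasoning
    8∤cy+1 : ¬ 8 ∣ c * y + 1
    8∤cy+1 8∣cy+1 = [c+1]%8≢0
      (trans (sym ([c*m^k+e]%d≡[c+e]%d c 9 (1 + t) 1 8 refl)) (n∣m⇒m%n≡0 _ 8 8∣cy+1))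
  ... | q , q-prime , q≢2 , q∣cy+1 = q , q-prime , q≢2 , q≢3 , q∣cy+1
    where
    q≢3 : q ≢ 3
    q≢3 refl = prime∤1 q-prime (∣m+n∣m⇒∣n q∣cy+1 (∣m⇒∣m*n (9 ^ (1 + t)) 3∣c))

  threePrimeDivisors-x[x²+1][x²+3]-3^[2+t] : ∀ t → let x = 3 ^ (2 + t) in
    ThreePrimeDivisorsOtherThan 3 (x * ((x * x + 1) * (x * x + 3)))
  threePrimeDivisors-x[x²+1][x²+3]-3^[2+t] t =
    combine (odd-prime-divisor≢3 9 t (divides 3 refl) (λ ())) (odd-prime-divisor≢3 3 t ∣-refl (λ ()))
    where
    x y N T : ℕ
    x = 3 ^ (2 + t)
    y = 9 ^ (1 + t)
    N = 9 * y + 1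
    T = 3 * y + 1
    3T≡N+2 : 3 * T ≡ N + 2
    3T≡N+2 = 3[3y+1]≡9y+1+2 y
      where
      3[3y+1]≡9y+1+2 : ∀ y → 3 * (3 * y + 1) ≡ 9 * y + 1 + 2
      3[3y+1]≡9y+1+2 = solve-∀
    x[x²+1][x²+3]≡xN[3T] : x * ((x * x + 1) * (x * x + 3)) ≡ x * (N * (3 * T))
    x[x²+1][x²+3]≡xN[3T] = trans (cong (λ w → x * ((w + 1) * (w + 3))) (m^n*m^n≡[m*m]^n 3 (2 + t)))
      (cong (λ w → x * (N * w)) (trans (sym (+-assoc (9 * y) 1 2)) (sym 3T≡N+2)))
    ∣x[x²+1][x²+3] : ∀ {p} → p ∣ N * (3 * T) → p ∣ x * ((x * x + 1) * (x * x + 3))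
    ∣x[x²+1][x²+3] {p} p∣N[3T] = subst (p ∣_) (sym x[x²+1][x²+3]≡xN[3T]) (∣n⇒∣m*n x p∣N[3T])
    2∣N : 2 ∣ N
    2∣N = m%n≡0⇒n∣m N 2 ([c*m^k+e]%d≡[c+e]%d 9 9 (1 + t) 1 2 refl)
    combine : ∃[ q ] Prime q × q ≢ 2 × q ≢ 3 × q ∣ N → ∃[ r ] Prime r × r ≢ 2 × r ≢ 3 × r ∣ T →
              ThreePrimeDivisorsOtherThan 3 (x * ((x * x + 1) * (x * x + 3)))
    combine (q , q-prime , q≢2 , q≢3 , q∣N) (r , r-prime , r≢2 , r≢3 , r∣T) =
      2 , q , r , prime[2] , q-prime , r-prime , q≢2 ∘ sym , r≢2 ∘ sym , q≢r , (λ ()) , q≢3 , r≢3 ,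
      ∣x[x²+1][x²+3] (∣m⇒∣m*n (3 * T) 2∣N) , ∣x[x²+1][x²+3] (∣m⇒∣m*n (3 * T) q∣N) ,
      ∣x[x²+1][x²+3] (∣n⇒∣m*n N (∣n⇒∣m*n 3 r∣T))
      where
      q≢r : q ≢ r
      q≢r refl = q≢2 (prime∣2⇒≡2 q-prime (∣m+n∣m⇒∣n (subst (q ∣_) 3T≡N+2 (∣n⇒∣m*n 3 r∣T)) q∣N))

  threePrimeDivisors-x[x²+1][x²+3] : ∀ s x → 2 ≤ s → x ≡ 3 ^ s →
                                     ThreePrimeDivisorsOtherThan 3 (x * ((x * x + 1) * (x * x + 3)))
  threePrimeDivisors-x[x²+1][x²+3] (suc (suc t)) _ (s≤s (s≤s _)) refl = threePrimeDivisors-x[x²+1][x²+3]-3^[2+t] t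

open import Data.Nat using (ℕ; _≤_; _^_)
open import Data.Nat.Primality using (Prime)
open import Data.Nat.Divisibility using (_∣_)
open import Data.Integer using (ℤ; ∣_∣; +_)
open import Data.Product using (_×_; ∃-syntax; _,_)
open import Relation.Binary.PropositionalEquality using (_≡_; _≢_; subst; sym; trans; cong)
open LucasTerms using (∣u₄∣≡; ∣u₆∣≡)
open PrimeDivisors

lemma5p3 : (a : ℤ) (p₁ s : ℕ) → Prime p₁ → 1 ≤ s → ∣ a ∣ ≡ p₁ ^ s → 6 ≤ ∣ a ∣ →
  (p₁ ≢ 3 → ∃[ p₂ ] ∃[ p₃ ] (Prime p₂ × Prime p₃ × p₂ ≢ p₃ × p₂ ≢ p₁ × p₃ ≢ p₁
      × (p₂ ∣ ∣ u a (+ 1) 4 ∣) × (p₃ ∣ ∣ u a (+ 1) 4 ∣)))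
  × (p₁ ≡ 3 → 2 ≤ s → ∃[ p₂ ] ∃[ p₃ ] ∃[ p₄ ] (Prime p₂ × Prime p₃ × Prime p₄
      × p₂ ≢ p₃ × p₂ ≢ p₄ × p₃ ≢ p₄ × p₂ ≢ 3 × p₃ ≢ 3 × p₄ ≢ 3
      × (p₂ ∣ ∣ u a (+ 1) 6 ∣) × (p₃ ∣ ∣ u a (+ 1) 6 ∣) × (p₄ ∣ ∣ u a (+ 1) 6 ∣)))
lemma5p3 a p₁ s p₁-prime 1≤s ∣a∣≡p₁^s 6≤∣a∣ = part₁ , part₂
  where
  part₁ : p₁ ≢ 3 → TwoPrimeDivisorsOtherThan p₁ ∣ u a (+ 1) 4 ∣
  part₁ p₁≢3 = subst (TwoPrimeDivisorsOtherThan p₁) (sym (∣u₄∣≡ a))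
    (twoPrimeDivisors-x[x²+2] p₁ s ∣ a ∣ p₁-prime p₁≢3 1≤s ∣a∣≡p₁^s 6≤∣a∣)
  part₂ : p₁ ≡ 3 → 2 ≤ s → ThreePrimeDivisorsOtherThan 3 ∣ u a (+ 1) 6 ∣
  part₂ p₁≡3 2≤s = subst (ThreePrimeDivisorsOtherThan 3) (sym (∣u₆∣≡ a))
    (threePrimeDivisors-x[x²+1][x²+3] s ∣ a ∣ 2≤s (trans ∣a∣≡p₁^s (cong (_^ s) p₁≡3)))
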